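{- For every $n$ and every integer $k$ with $0 < k \le n-2$, there is a family of partial orders $P$ on an $n$-element set, each having a unique maximum chain, of length $n-k$, such that any algorithm that finds the maximum chain given access to a partial oracle $O_P$ needs $\Omega(k^2)$ time (partial oracle queries).
   Context: A partial oracle $O_P$ answers, for any ordered pair $(x_i,x_j)$ of distinct elements, whether $x_i \prec_P x_j$. A chain is a set of pairwise comparable elements; its length is its cardinality; a maximum chain is a chain of maximal length. -}

module Defs where

open import Data.Nat using (ℕ; suc; _≤_)
open import Data.Bool using (Bool; true; false; T)
open import Data.Fin using (Fin)
open import Data.Fin.Subset using (Subset; _∈_; ∣_∣)
open import Data.Sum using (_⊎_)
open import Data.Product using (Σ; _×_)
open import Relation.Binary.PropositionalEquality using (_≡_; _≢_)
open import Relation.Binary.Structures using (IsStrictPartialOrder)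

-- A (strict) partial order on the n-element set Fin n.  The relation is
-- given as a Bool-valued function, so that it can be queried by an oracle.
record PO (n : ℕ) : Set where
  field
    rel : Fin n → Fin n → Bool
    isSPO : IsStrictPartialOrder _≡_ (λ x y → T (rel x y))

_≺[_]_ : ∀ {n} → Fin n → PO n → Fin n → Set
x ≺[ P ] y = T (PO.rel P x y)

IsChain : ∀ {n} → PO n → Subset n → Set
IsChain P C = ∀ x y → x ∈ C → y ∈ C → x ≢ y → (x ≺[ P ] y) ⊎ (y ≺[ P ] x)

IsMaxChain : ∀ {n} → PO n → Subset n → Set
IsMaxChain P C = IsChain P C × (∀ D → IsChain P D → ∣ D ∣ ≤ ∣ C ∣)

HasUniqueMaxChainOfLength : ∀ {n} → PO n → ℕ → Set
HasUniqueMaxChainOfLength P ℓ =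
  Σ _ λ C → IsMaxChain P C × (∀ D → IsMaxChain P D → D ≡ C) × ∣ C ∣ ≡ ℓ

-- Deterministic adaptive algorithms with access to the partial oracle,
-- modelled as decision trees: an inner node queries an ordered pair
-- (x_i , x_j) and branches on the answer to "x_i ≺_P x_j"; a leaf outputs
-- a subset (the claimed maximum chain).
data Alg (n : ℕ) : Set where
  output : Subset n → Alg n
  query  : Fin n → Fin n → (Bool → Alg n) → Alg n

run : ∀ {n} → Alg n → PO n → Subset n
run (output C)    P = C
run (query i j k) P = run (k (PO.rel P i j)) P

queries : ∀ {n} → Alg n → PO n → ℕ
queries (output C)    P = 0
queries (query i j k) P = suc (queries (k (PO.rel P i j)) P)

{-# OPTIONS --safe #-}
-- Let m = k + 2. On Fin n, let the elements of index ≥ m form a chain lying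
-- above all the others, and let the m elements below it be an antichain except
-- for one comparable pair a < b. The unique maximum chain is {a, b} together
-- with the top chain, of length n − k, and it determines (a, b). An adversary
-- answers every query as in the order without the pair: a query (i , j) is
-- then wrong for the single candidate (i , j) only, and the algorithm cannot
-- stop while two candidates, whose maximum chains differ, remain. So some
-- candidate costs at least m (m − 1) / 2 − 1 ≥ k² / 2 queries.

module Submission where

open import Defs
open import Level using (0ℓ)
open import Data.Bool using (Bool)
open import Data.Fin.Base as Fin using (Fin; toℕ; fromℕ<; zero; suc)
import Data.Fin.Properties as Finₚ
open import Data.Fin.Subset
  using (Subset; inside; outside; ⊤; ⁅_⁆; _∪_; _⊆_; ∣_∣; _∈_; _∉_)
open import Data.Fin.Subset.Properties
  using (∈⊤; ∣⊤∣≡n; ∪-identityʳ; p⊆q⇒∣p∣≤∣q∣; p⊂q⇒∣p∣<∣q∣; ⊆-antisym; _∈?_;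
         x∈p∪q⁺; x∈p∪q⁻; x∈⁅x⁆; x∈⁅y⁆⇒x≡y)
open import Data.List using (List; []; _∷_; length; filter; map; upTo; _++_)
open import Data.List.Properties using (filter-all; length-++; length-map; length-upTo)
open import Data.List.Membership.Propositional using () renaming (_∈_ to _∈ₗ_)
open import Data.List.Membership.Propositional.Properties using (∈-filter⁻; ∈-++⁻; ∈-map⁻; ∈-upTo⁻)
open import Data.List.Relation.Binary.Disjoint.Propositional using (Disjoint)
open import Data.List.Relation.Unary.All as All using (All; _∷_)
open import Data.List.Relation.Unary.AllPairs using ([]; _∷_)
open import Data.List.Relation.Unary.Any using (here; there)
open import Data.List.Relation.Unary.Unique.Propositional using (Unique)
import Data.List.Relation.Unary.Unique.Propositional.Properties as Unique
open import Data.Vec using ([]; _∷_; here; there)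
open import Data.Nat using (ℕ; zero; suc; _+_; _*_; _∸_; _≤_; _<_; z≤n; s≤s)
open import Data.Nat.Tactic.RingSolver using (solve-∀)
import Data.Nat.Properties as ℕ
open import Data.Product as Product using (Σ; ∃-syntax; _×_; _,_; proj₁; proj₂)
open import Data.Product.Properties using (,-injective; ,-injectiveˡ; ≡-dec)
open import Data.Sum as Sum using (_⊎_; inj₁; inj₂; [_,_]′)
open import Function using (_∘_; id; _⇔_; mk⇔)
open import Relation.Binary
  using (Rel; Decidable; DecidableEquality; IsStrictPartialOrder; tri<; tri≈; tri>)
import Relation.Binary.PropositionalEquality as ≡
open import Relation.Binary.PropositionalEquality
  using (_≡_; _≢_; refl; sym; trans; cong; cong₂; subst; subst₂; resp₂; module ≡-Reasoning)
open import Relation.Nullary using (Dec; ¬?; yes; no; does; contradiction; _×-dec_; _⊎-dec_)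
open import Relation.Nullary.Decidable
  using (decidable-stable; ⌊_⌋; toWitness; fromWitness; isYes≗does; does-⇔)

decPO : ∀ {n} {_≺_ : Rel (Fin n) 0ℓ} →
        Decidable _≺_ → IsStrictPartialOrder _≡_ _≺_ → PO n
decPO {_≺_ = _≺_} _≺?_ spo = record
  { rel   = λ x y → ⌊ x ≺? y ⌋
  ; isSPO = record
    { isEquivalence = isEquivalence
    ; irrefl        = λ x≡y x≺y → ≺-irrefl x≡y (toWitness x≺y)
    ; trans         = λ x≺y y≺z → fromWitness (≺-trans (toWitness x≺y) (toWitness y≺z))
    ; <-resp-≈      = resp₂ _
    }
  }
  where open IsStrictPartialOrder spo renaming (irrefl to ≺-irrefl; trans to ≺-trans)

dominating⇒uniqueMaxChain : ∀ {n} {P : PO n} {C : Subset n} → IsChain P C →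
                 (∀ D → IsChain P D → D ⊆ C ⊎ ∣ D ∣ < ∣ C ∣) →
                 IsMaxChain P C × (∀ D → IsMaxChain P D → D ≡ C)
dominating⇒uniqueMaxChain {P = P} {C} C-chain dominated = (C-chain , maximal) , unique
  where
  maximal : ∀ D → IsChain P D → ∣ D ∣ ≤ ∣ C ∣
  maximal D D-chain = [ p⊆q⇒∣p∣≤∣q∣ , ℕ.<⇒≤ ]′ (dominated D D-chain)

  unique : ∀ D → IsMaxChain P D → D ≡ C
  unique D (D-chain , D-max) with dominated D D-chain
  ... | inj₂ ∣D∣<∣C∣ = contradiction (D-max C C-chain) (ℕ.<⇒≱ ∣D∣<∣C∣)
  ... | inj₁ D⊆C = ⊆-antisym D⊆C C⊆D
    where
    C⊆D : C ⊆ D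
    C⊆D {x} x∈C with x ∈? D
    ... | yes x∈D = x∈D
    ... | no  x∉D = contradiction (D-max C C-chain) (ℕ.<⇒≱ (p⊂q⇒∣p∣<∣q∣ (D⊆C , x , x∈C , x∉D)))

atLeast : ∀ {n} → ℕ → Subset n
atLeast {zero}  _       = []
atLeast {suc n} zero    = ⊤
atLeast {suc n} (suc m) = outside ∷ atLeast m

∣atLeast∣ : ∀ n m → ∣ atLeast {n} m ∣ ≡ n ∸ m
∣atLeast∣ zero    zero    = refl
∣atLeast∣ zero    (suc m) = refl
∣atLeast∣ (suc n) zero    = ∣⊤∣≡n (suc n)
∣atLeast∣ (suc n) (suc m) = ∣atLeast∣ n m

∈atLeast⁺ : ∀ {n m} {x : Fin n} → m ≤ toℕ x → x ∈ atLeast m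
∈atLeast⁺ {suc n} {zero}          _         = ∈⊤
∈atLeast⁺ {suc n} {suc m} {suc x} (s≤s m≤x) = there (∈atLeast⁺ m≤x)

∈atLeast⁻ : ∀ {n m} {x : Fin n} → x ∈ atLeast m → m ≤ toℕ x
∈atLeast⁻ {suc n} {zero}                  _         = z≤n
∈atLeast⁻ {suc n} {suc m} {suc x} (there x∈) = s≤s (∈atLeast⁻ x∈)

x∉p⇒∣p∪⁅x⁆∣≡1+∣p∣ : ∀ {n} {p : Subset n} {x} → x ∉ p → ∣ p ∪ ⁅ x ⁆ ∣ ≡ suc ∣ p ∣
x∉p⇒∣p∪⁅x⁆∣≡1+∣p∣ {p = outside ∷ p} {zero}  _   = cong (suc ∘ ∣_∣) (∪-identityʳ p)
x∉p⇒∣p∪⁅x⁆∣≡1+∣p∣ {p = inside  ∷ p} {zero}  x∉p = contradiction here x∉p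
x∉p⇒∣p∪⁅x⁆∣≡1+∣p∣ {p = outside ∷ p} {suc x} x∉p = x∉p⇒∣p∪⁅x⁆∣≡1+∣p∣ (x∉p ∘ there)
x∉p⇒∣p∪⁅x⁆∣≡1+∣p∣ {p = inside  ∷ p} {suc x} x∉p = cong suc (x∉p⇒∣p∪⁅x⁆∣≡1+∣p∣ (x∉p ∘ there))

module Adversary {n : ℕ} {Cand : Set} (_≟_ : DecidableEquality Cand)
  (order : Cand → PO n) (base : Fin n → Fin n → Bool) (key : Fin n → Fin n → Cand)
  (agree : ∀ p i j → key i j ≢ p → PO.rel (order p) i j ≡ base i j) where

  Solves : Alg n → List Cand → Set
  Solves A S = ∀ {p} → p ∈ₗ S → IsMaxChain (order p) (run A (order p))

  Separated : List Cand → Set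
  Separated S = ∀ {p q} → p ∈ₗ S → q ∈ₗ S →
                ∀ X → IsMaxChain (order p) X → IsMaxChain (order q) X → p ≡ q

  without : Cand → List Cand → List Cand
  without q = filter (λ p → ¬? (p ≟ q))

  without-⊆ : ∀ q S {p} → p ∈ₗ without q S → p ∈ₗ S
  without-⊆ q S = proj₁ ∘ ∈-filter⁻ (λ p → ¬? (p ≟ q)) {xs = S}

  without-≢ : ∀ q S {p} → p ∈ₗ without q S → q ≢ p
  without-≢ q S p∈ q≡p = proj₂ (∈-filter⁻ (λ p → ¬? (p ≟ q)) {xs = S} p∈) (sym q≡p)

  length-without : ∀ q {S} → Unique S → length S ≤ suc (length (without q S))
  length-without q {[]}    _ = z≤n
  length-without q {x ∷ S} (x∉S ∷ S-unique) with x ≟ q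
  ... | yes refl = s≤s (ℕ.≤-reflexive (cong length (sym (filter-all _ (All.map (_∘ sym) x∉S)))))
  ... | no  _    = s≤s (length-without q S-unique)

  run-unaffected : ∀ {p i j} k → key i j ≢ p →
                   run (query i j k) (order p) ≡ run (k (base i j)) (order p)
  run-unaffected {p} {i} {j} k q≢p rewrite agree p i j q≢p = refl

  queries-unaffected : ∀ {p i j} k → key i j ≢ p →
                       queries (query i j k) (order p) ≡ suc (queries (k (base i j)) (order p))
  queries-unaffected {p} {i} {j} k q≢p rewrite agree p i j q≢p = refl

  without-separated : ∀ q S → Separated S → Separated (without q S)
  without-separated q S separated p∈ q∈ = separated (without-⊆ q S p∈) (without-⊆ q S q∈)

  without-solves : ∀ i j k S → Solves (query i j k) S → Solves (k (base i j)) (without (key i j) S)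
  without-solves i j k S solves {p} p∈ =
    subst (IsMaxChain (order p)) (run-unaffected k (without-≢ (key i j) S p∈))
          (solves (without-⊆ (key i j) S p∈))

  adversary-bound : ∀ A {S} → Unique S → Separated S → Solves A S → ∀ {p₀} → p₀ ∈ₗ S →
                    ∃[ p ] p ∈ₗ S × length S ≤ suc (queries A (order p))
  adversary-bound (output C) {x ∷ []} _ _ _ _ = x , here refl , s≤s z≤n
  adversary-bound (output C) {x ∷ y ∷ _} ((x≢y ∷ _) ∷ _) separated solves _ =
    contradiction (separated (here refl) (there (here refl)) C
                             (solves (here refl)) (solves (there (here refl)))) x≢y
  adversary-bound (query i j k) {S} S-unique separated solves {p₀} p₀∈S
    with without (key i j) S in S′≡
  ... | [] = p₀ , p₀∈S , ℕ.≤-trans ∣S∣≤1 (s≤s z≤n)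
    where
    ∣S∣≤1 : length S ≤ 1
    ∣S∣≤1 = subst (λ S′ → length S ≤ suc (length S′)) S′≡ (length-without (key i j) S-unique)
  ... | p₁ ∷ _
    with p , p∈S′ , ∣S′∣≤1+q ←
      adversary-bound (k (base i j)) (Unique.filter⁺ _ S-unique)
        (without-separated (key i j) S separated) (without-solves i j k S solves)
        (subst (p₁ ∈ₗ_) (sym S′≡) (here refl))
    = p , without-⊆ (key i j) S p∈S′ , (begin
        length S                                     ≤⟨ length-without (key i j) S-unique ⟩
        suc (length (without (key i j) S))           ≤⟨ s≤s ∣S′∣≤1+q ⟩
        suc (suc (queries (k (base i j)) (order p))) ≡⟨ cong suc (queries-unaffected k q≢p) ⟨
        suc (queries (query i j k) (order p))        ∎)
    where
    open ℕ.≤-Reasoning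
    q≢p : key i j ≢ p
    q≢p = without-≢ (key i j) S p∈S′

pairsBelow : ℕ → List (ℕ × ℕ)
pairsBelow zero    = []
pairsBelow (suc m) = map (_, m) (upTo m) ++ pairsBelow m

∈pairsBelow⁻ : ∀ m {a b} → (a , b) ∈ₗ pairsBelow m → a < b × b < m
∈pairsBelow⁻ (suc m) ab∈ with ∈-++⁻ (map (_, m) (upTo m)) ab∈
... | inj₁ ab∈row with a , a∈ , refl ← ∈-map⁻ (_, m) ab∈row = ∈-upTo⁻ a∈ , ℕ.n<1+n m
... | inj₂ ab∈rest = Product.map₂ ℕ.m<n⇒m<1+n (∈pairsBelow⁻ m ab∈rest)

pairsBelow-unique : ∀ m → Unique (pairsBelow m)
pairsBelow-unique zero    = []
pairsBelow-unique (suc m) =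
  Unique.++⁺ (Unique.map⁺ (,-injectiveˡ) (Unique.upTo⁺ m)) (pairsBelow-unique m) disjoint
  where
  disjoint : Disjoint (map (_, m) (upTo m)) (pairsBelow m)
  disjoint (ab∈row , ab∈rest) with _ , _ , refl ← ∈-map⁻ (_, m) ab∈row =
    ℕ.<-irrefl refl (proj₂ (∈pairsBelow⁻ m ab∈rest))

length-pairsBelow : ∀ m → 2 * length (pairsBelow (suc m)) ≡ suc m * m
length-pairsBelow zero    = refl
length-pairsBelow (suc m) = begin
  2 * length (row ++ pairsBelow (suc m)) ≡⟨ cong (2 *_) (length-++ row) ⟩
  2 * (length row + L)                  ≡⟨ cong (λ r → 2 * (r + L)) ∣row∣ ⟩
  2 * (suc m + L)                       ≡⟨ ℕ.*-distribˡ-+ 2 (suc m) L ⟩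
  2 * suc m + 2 * L                     ≡⟨ cong (2 * suc m +_) (length-pairsBelow m) ⟩
  2 * suc m + suc m * m                 ≡⟨ expand m ⟩
  suc (suc m) * suc m                   ∎
  where
  open ≡-Reasoning
  row = map (_, suc m) (upTo (suc m))
  L = length (pairsBelow (suc m))
  ∣row∣ : length row ≡ suc m
  ∣row∣ = trans (length-map _ (upTo (suc m))) (length-upTo (suc m))
  expand : ∀ m → 2 * suc m + suc m * m ≡ suc (suc m) * suc m
  expand = solve-∀

module Construction {n : ℕ} (m : ℕ) where

  _≺₀_ : Rel (Fin n) 0ℓ
  x ≺₀ y = x Fin.< y × m ≤ toℕ y

  -- The side conditions make `order p` a strict order for every p, valid pair or not.
  Key : ℕ × ℕ → Rel (Fin n) 0ℓ
  Key p x y = (toℕ x , toℕ y) ≡ p × x Fin.< y × toℕ y < m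

  _≺⟨_⟩_ : Fin n → ℕ × ℕ → Fin n → Set
  x ≺⟨ p ⟩ y = x ≺₀ y ⊎ Key p x y

  _≺₀?_ : Decidable _≺₀_
  x ≺₀? y = x Finₚ.<? y ×-dec m ℕ.≤? toℕ y

  _≺⟨_⟩?_ : ∀ x p y → Dec (x ≺⟨ p ⟩ y)
  x ≺⟨ p ⟩? y =
    x ≺₀? y ⊎-dec (≡-dec ℕ._≟_ ℕ._≟_ (toℕ x , toℕ y) p ×-dec x Finₚ.<? y ×-dec toℕ y ℕ.<? m)

  ≺⇒< : ∀ {p x y} → x ≺⟨ p ⟩ y → x Fin.< y
  ≺⇒< = [ proj₁ , proj₁ ∘ proj₂ ]′

  ≺-trans : ∀ {p x y z} → x ≺⟨ p ⟩ y → y ≺⟨ p ⟩ z → x ≺⟨ p ⟩ z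
  ≺-trans x≺y (inj₁ (y<z , m≤z)) = inj₁ (Finₚ.<-trans (≺⇒< x≺y) y<z , m≤z)
  ≺-trans (inj₁ (_ , m≤y)) (inj₂ (_ , y<z , z<m)) = contradiction (ℕ.<-trans y<z z<m) (ℕ.≤⇒≯ m≤y)
  ≺-trans (inj₂ (xy≡p , x<y , _)) (inj₂ (yz≡p , _)) =
    contradiction (,-injectiveˡ (trans yz≡p (sym xy≡p))) (ℕ.<⇒≢ x<y ∘ sym)

  ≺-isStrictPartialOrder : ∀ p → IsStrictPartialOrder _≡_ (_≺⟨ p ⟩_)
  ≺-isStrictPartialOrder p = record
    { isEquivalence = ≡.isEquivalence
    ; irrefl        = λ x≡y x≺y → Finₚ.<-irrefl x≡y (≺⇒< x≺y)
    ; trans         = ≺-trans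
    ; <-resp-≈      = resp₂ _
    }

  order : ℕ × ℕ → PO n
  order p = decPO (_≺⟨ p ⟩?_) (≺-isStrictPartialOrder p)

  base : Fin n → Fin n → Bool
  base x y = ⌊ x ≺₀? y ⌋

  agree : ∀ p i j → (toℕ i , toℕ j) ≢ p → PO.rel (order p) i j ≡ base i j
  agree p i j ij≢p = begin
    ⌊ i ≺⟨ p ⟩? j ⌋    ≡⟨ isYes≗does _ ⟩
    does (i ≺⟨ p ⟩? j) ≡⟨ does-⇔ unaffected (i ≺⟨ p ⟩? j) (i ≺₀? j) ⟩
    does (i ≺₀? j)     ≡⟨ isYes≗does _ ⟨
    ⌊ i ≺₀? j ⌋        ∎
    where
    open ≡-Reasoning
    unaffected : i ≺⟨ p ⟩ j ⇔ i ≺₀ j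
    unaffected = mk⇔ [ id , (λ key → contradiction (proj₁ key) ij≢p) ]′ inj₁

  ≺⁺ : ∀ {p x y} → x ≺⟨ p ⟩ y → x ≺[ order p ] y
  ≺⁺ {p} {x} {y} = fromWitness {a? = x ≺⟨ p ⟩? y}

  ≺⁻ : ∀ {p x y} → x ≺[ order p ] y → x ≺⟨ p ⟩ y
  ≺⁻ {p} {x} {y} = toWitness {a? = x ≺⟨ p ⟩? y}

  ≺-bottom : ∀ {p x y} → x ≺⟨ p ⟩ y → toℕ y < m → Key p x y
  ≺-bottom (inj₁ (_ , m≤y)) y<m = contradiction y<m (ℕ.≤⇒≯ m≤y)
  ≺-bottom (inj₂ key)       _   = key

  top-comparable : ∀ {p x y} → m ≤ toℕ y → x ≢ y → x ≺⟨ p ⟩ y ⊎ y ≺⟨ p ⟩ x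
  top-comparable {x = x} {y} m≤y x≢y with Finₚ.<-cmp x y
  ... | tri< x<y _ _ = inj₁ (inj₁ (x<y , m≤y))
  ... | tri≈ _ x≡y _ = contradiction x≡y x≢y
  ... | tri> _ _ y<x = inj₂ (inj₁ (y<x , ℕ.≤-trans m≤y (ℕ.<⇒≤ y<x)))

  module Chain {a b : Fin n} (a<b : a Fin.< b) (b<m : toℕ b < m) where

    p : ℕ × ℕ
    p = toℕ a , toℕ b

    chain : Subset n
    chain = (atLeast m ∪ ⁅ a ⁆) ∪ ⁅ b ⁆

    ∈chain⁺ : ∀ {x} → (m ≤ toℕ x ⊎ x ≡ a) ⊎ x ≡ b → x ∈ chain
    ∈chain⁺ = x∈p∪q⁺ ∘ Sum.map (x∈p∪q⁺ ∘ Sum.map ∈atLeast⁺ λ { refl → x∈⁅x⁆ a })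
                               λ { refl → x∈⁅x⁆ b }

    ∈chain⁻ : ∀ {x} → x ∈ chain → (m ≤ toℕ x ⊎ x ≡ a) ⊎ x ≡ b
    ∈chain⁻ = Sum.map (Sum.map ∈atLeast⁻ (x∈⁅y⁆⇒x≡y a) ∘ x∈p∪q⁻ _ _) (x∈⁅y⁆⇒x≡y b) ∘ x∈p∪q⁻ _ _

    key-ends : ∀ {x y} → Key p x y → x ≡ a × y ≡ b
    key-ends = Product.map Finₚ.toℕ-injective Finₚ.toℕ-injective ∘ ,-injective ∘ proj₁

    chain-isChain : IsChain (order p) chain
    chain-isChain x y x∈ y∈ x≢y = Sum.map ≺⁺ ≺⁺ (comparable (∈chain⁻ x∈) (∈chain⁻ y∈))
      where
      comparable : (m ≤ toℕ x ⊎ x ≡ a) ⊎ x ≡ b → (m ≤ toℕ y ⊎ y ≡ a) ⊎ y ≡ b →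
                   x ≺⟨ p ⟩ y ⊎ y ≺⟨ p ⟩ x
      comparable _                  (inj₁ (inj₁ m≤y)) = top-comparable m≤y x≢y
      comparable (inj₁ (inj₁ m≤x))  _                 = Sum.swap (top-comparable m≤x (x≢y ∘ sym))
      comparable (inj₁ (inj₂ refl)) (inj₂ refl)       = inj₁ (inj₂ (refl , a<b , b<m))
      comparable (inj₂ refl)        (inj₁ (inj₂ refl)) = inj₂ (inj₂ (refl , a<b , b<m))
      comparable (inj₁ (inj₂ refl)) (inj₁ (inj₂ refl)) = contradiction refl x≢y
      comparable (inj₂ refl)        (inj₂ refl)       = contradiction refl x≢y

    ∣chain∣ : ∣ chain ∣ ≡ 2 + (n ∸ m)
    ∣chain∣ = begin
      ∣ (atLeast m ∪ ⁅ a ⁆) ∪ ⁅ b ⁆ ∣ ≡⟨ x∉p⇒∣p∪⁅x⁆∣≡1+∣p∣ b∉ ⟩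
      1 + ∣ atLeast m ∪ ⁅ a ⁆ ∣       ≡⟨ cong (1 +_) (x∉p⇒∣p∪⁅x⁆∣≡1+∣p∣ a∉) ⟩
      2 + ∣ atLeast {n} m ∣           ≡⟨ cong (2 +_) (∣atLeast∣ n m) ⟩
      2 + (n ∸ m)                     ∎
      where
      open ≡-Reasoning
      a∉ : a ∉ atLeast m
      a∉ = ℕ.<⇒≱ (ℕ.<-trans a<b b<m) ∘ ∈atLeast⁻
      b∉ : b ∉ atLeast m ∪ ⁅ a ⁆
      b∉ = [ ℕ.<⇒≱ b<m ∘ ∈atLeast⁻ , (λ b≡a → Finₚ.<-irrefl (sym b≡a) a<b) ∘ x∈⁅y⁆⇒x≡y a ]′
         ∘ x∈p∪q⁻ _ _

    chain-escape : ∀ {D x} → IsChain (order p) D → x ∈ D → x ∉ chain → D ⊆ atLeast m ∪ ⁅ x ⁆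
    chain-escape {D} {x} D-chain x∈D x∉chain {y} y∈D with y Finₚ.≟ x
    ... | yes refl = x∈p∪q⁺ (inj₂ (x∈⁅x⁆ x))
    ... | no  y≢x with Sum.map ≺⁻ ≺⁻ (D-chain x y x∈D y∈D (y≢x ∘ sym))
    ...   | inj₁ (inj₁ (_ , m≤y)) = x∈p∪q⁺ (inj₁ (∈atLeast⁺ m≤y))
    ...   | inj₁ (inj₂ key) =
      contradiction (∈chain⁺ (inj₁ (inj₂ (proj₁ (key-ends key))))) x∉chain
    ...   | inj₂ y≺x =
      contradiction (∈chain⁺ (inj₂ (proj₂ (key-ends (≺-bottom y≺x x<m))))) x∉chain
      where
      x<m : toℕ x < m
      x<m = ℕ.≰⇒> (x∉chain ∘ ∈chain⁺ ∘ inj₁ ∘ inj₁)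

    chain-dominates : ∀ D → IsChain (order p) D → D ⊆ chain ⊎ ∣ D ∣ < ∣ chain ∣
    chain-dominates D D-chain with Finₚ.any? (λ x → x ∈? D ×-dec ¬? (x ∈? chain))
    ... | no  D⊆chain =
      inj₁ λ {x} x∈D → decidable-stable (x ∈? chain) (λ x∉ → D⊆chain (x , x∈D , x∉))
    ... | yes (x , x∈D , x∉chain) = inj₂ (begin-strict
      ∣ D ∣                   ≤⟨ p⊆q⇒∣p∣≤∣q∣ (chain-escape D-chain x∈D x∉chain) ⟩
      ∣ atLeast m ∪ ⁅ x ⁆ ∣   ≡⟨ x∉p⇒∣p∪⁅x⁆∣≡1+∣p∣ (x∉chain ∘ ∈chain⁺ ∘ inj₁ ∘ inj₁ ∘ ∈atLeast⁻) ⟩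
      1 + ∣ atLeast {n} m ∣   ≡⟨ cong (1 +_) (∣atLeast∣ n m) ⟩
      1 + (n ∸ m)             <⟨ ℕ.n<1+n _ ⟩
      2 + (n ∸ m)             ≡⟨ ∣chain∣ ⟨
      ∣ chain ∣               ∎)
      where open ℕ.≤-Reasoning

    chain-uniqueMax : IsMaxChain (order p) chain × (∀ D → IsMaxChain (order p) D → D ≡ chain)
    chain-uniqueMax = dominating⇒uniqueMaxChain {P = order p} chain-isChain chain-dominates

    chain-determines : ∀ q → IsChain (order q) chain → p ≡ q
    chain-determines q chain-isChainq
      with Sum.map ≺⁻ ≺⁻ (chain-isChainq a b (∈chain⁺ (inj₁ (inj₂ refl))) (∈chain⁺ (inj₂ refl))
                                          (Finₚ.<⇒≢ a<b))
    ... | inj₁ a≺b = proj₁ (≺-bottom a≺b b<m)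
    ... | inj₂ b≺a = contradiction (proj₁ (proj₂ (≺-bottom b≺a (ℕ.<-trans a<b b<m)))) (ℕ.<-asym a<b)

    chain-separates : ∀ q X → IsMaxChain (order p) X → IsMaxChain (order q) X → p ≡ q
    chain-separates q X X-max X-maxq =
      chain-determines q (subst (IsChain (order q)) (proj₂ chain-uniqueMax X X-max) (proj₁ X-maxq))

  ∈pairsBelow⇒Fin : m ≤ n → ∀ {p} → p ∈ₗ pairsBelow m →
                    ∃[ a ] ∃[ b ] a Fin.< b × toℕ b < m × p ≡ (toℕ a , toℕ b)
  ∈pairsBelow⇒Fin m≤n {a , b} ab∈ with a<b , b<m ← ∈pairsBelow⁻ m ab∈ =
    fromℕ< a<n , fromℕ< b<n ,
    subst₂ _<_ (sym toℕ-a) (sym toℕ-b) a<b , subst (_< m) (sym toℕ-b) b<m ,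
    sym (cong₂ _,_ toℕ-a toℕ-b)
    where
    b<n = ℕ.<-≤-trans b<m m≤n
    a<n = ℕ.<-trans a<b b<n
    toℕ-a = Finₚ.toℕ-fromℕ< a<n
    toℕ-b = Finₚ.toℕ-fromℕ< b<n

HardFamily : (n k c : ℕ) → Set₁
HardFamily n k c =
  Σ (PO n → Set) λ F →
    (∀ P → F P → HasUniqueMaxChainOfLength P (n ∸ k)) ×
    (∀ (A : Alg n) → (∀ P → F P → IsMaxChain P (run A P)) →
      Σ (PO n) λ P → F P × k * k ≤ c * queries A P)

[2+k]*[1+k]≤2*[1+q]⇒k*k≤2*q : ∀ k q → (2 + k) * (1 + k) ≤ 2 * suc q → k * k ≤ 2 * q
[2+k]*[1+k]≤2*[1+q]⇒k*k≤2*q k q h = ℕ.+-cancelˡ-≤ 2 (k * k) (2 * q) (begin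
  2 + k * k               ≤⟨ ℕ.m≤m+n (2 + k * k) (3 * k) ⟩
  2 + k * k + 3 * k       ≡⟨ expand k ⟩
  (2 + k) * (1 + k)       ≤⟨ h ⟩
  2 * suc q               ≡⟨ ℕ.*-suc 2 q ⟩
  2 + 2 * q               ∎)
  where
  open ℕ.≤-Reasoning
  expand : ∀ k → 2 + k * k + 3 * k ≡ (2 + k) * (1 + k)
  expand = solve-∀

hardFamily : ∀ n k → k ≤ n → HardFamily (2 + n) k 2
hardFamily n k k≤n = Family , uniqueMax , lowerBound
  where
  open Construction {2 + n} (2 + k)
  open Adversary (≡-dec ℕ._≟_ ℕ._≟_) order base (λ i j → toℕ i , toℕ j) agree

  m≤n : 2 + k ≤ 2 + n
  m≤n = s≤s (s≤s k≤n)

  Family : PO (2 + n) → Set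
  Family P = ∃[ p ] p ∈ₗ pairsBelow (2 + k) × order p ≡ P

  uniqueMax : ∀ P → Family P → HasUniqueMaxChainOfLength P ((2 + n) ∸ k)
  uniqueMax _ (_ , p∈ , refl) with _ , _ , a<b , b<m , refl ← ∈pairsBelow⇒Fin m≤n p∈ =
    chain , chain-uniqueMax .proj₁ , chain-uniqueMax .proj₂ ,
    trans ∣chain∣ (sym (ℕ.+-∸-assoc 2 k≤n))
    where open Chain a<b b<m

  separated : Separated (pairsBelow (2 + k))
  separated p∈ _ with _ , _ , a<b , b<m , refl ← ∈pairsBelow⇒Fin m≤n p∈ =
    Chain.chain-separates a<b b<m _

  lowerBound : ∀ A → (∀ P → Family P → IsMaxChain P (run A P)) →
               Σ (PO (2 + n)) λ P → Family P × k * k ≤ 2 * queries A P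
  lowerBound A solves
    with p , p∈ , ∣S∣≤1+q ← adversary-bound A (pairsBelow-unique (2 + k)) separated
                                     (λ p∈ → solves _ (_ , p∈ , refl)) (here refl) =
    order p , (p , p∈ , refl) , [2+k]*[1+k]≤2*[1+q]⇒k*k≤2*q k (queries A (order p)) (begin
      (2 + k) * (1 + k)               ≡⟨ length-pairsBelow (1 + k) ⟨
      2 * length (pairsBelow (2 + k)) ≤⟨ ℕ.*-monoʳ-≤ 2 ∣S∣≤1+q ⟩
      2 * suc (queries A (order p))   ∎)
    where open ℕ.≤-Reasoning

lemma30 : Σ ℕ λ c → Σ ℕ λ k₀ → 0 < c ×
    (∀ n k → 0 < k → k ≤ n ∸ 2 → k₀ ≤ k →
      Σ (PO n → Set) λ F →
        (∀ P → F P → HasUniqueMaxChainOfLength P (n ∸ k)) ×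
        (∀ (A : Alg n) → (∀ P → F P → IsMaxChain P (run A P)) →
          Σ (PO n) λ P → F P × k * k ≤ c * queries A P))
lemma30 = 2 , 0 , s≤s z≤n , family
  where
  family : ∀ n k → 0 < k → k ≤ n ∸ 2 → 0 ≤ k → HardFamily n k 2
  family (suc (suc n)) k _   k≤n _ = hardFamily n k k≤n
  family 0             _ 0<k k≤0 _ = contradiction k≤0 (ℕ.<⇒≱ 0<k)
  family 1             _ 0<k k≤0 _ = contradiction k≤0 (ℕ.<⇒≱ 0<k)
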